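{- Let $r\ge 2$ be an integer and let $(q_k)_{k\ge 1}$ be a sequence such that for every value $v$ taken by the sequence, the set of positions $\{k\ge 1: q_k=v\}$ is an infinite arithmetic progression $\{n_v+r^{m_v}j : j\in\mathbb{N}_0\}$ with $m_v\in\mathbb{N}$ and $1\le n_v\le r^{m_v}$. Let $p\in\mathbb{N}$ be coprime to $r$, let $c\in\mathbb{N}$, and consider the sampled sequence $s_k=q_{kp+c}$, $k\ge 0$. Then for every value $v$ taken by $(q_k)$, the set $\{k\ge 0: s_k=v\}$ is nonempty and is an arithmetic progression with difference $r^{m_v}$, i.e. the intervals between consecutive occurrences of $v$ in $(s_k)$ equal those in $(q_k)$.
   Context: $\mathbb{N}=\{1,2,3,\dots\}$, $\mathbb{N}_0=\{0\}\cup\mathbb{N}$. In the paper's terminology, the "interval" of a value in a periodic sequence is the fixed distance between two consecutive occurrences of that value, and a "sampling period" $p$ means taking every $p$-th term. -}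

module Defs where

open import Level using (Level)
open import Data.Nat using (ℕ; _+_; _*_; _^_; _≤_)
open import Data.Product using (_×_; ∃-syntax)
open import Function.Bundles using (_⇔_)
open import Relation.Binary.PropositionalEquality using (_≡_)

PositionsAP : {A : Set} → (r : ℕ) → (q : ℕ → A) → (v : A) → (m n : ℕ) → Set
PositionsAP r q v m n =
  (1 ≤ m) × (1 ≤ n) × (n ≤ r ^ m) ×
  ((k : ℕ) → 1 ≤ k → ((q k ≡ v) ⇔ (∃[ j ] (k ≡ n + r ^ m * j))))

{-# OPTIONS --safe #-}
-- Writing R = r ^ m, the positions of v are the k ≥ 1 with k ∈ n + Rℕ.  Since p is invertible
-- modulo R, k ↦ k * p + c permutes the residues modulo R, so the k with k * p + c ∈ n + Rℕ form
-- a single residue class modulo R, cut off below by the condition k * p + c ≥ n.  Such a set is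
-- the progression a + Rℕ starting at its least element a.
module Submission where

open import Defs
open import Data.Empty using (⊥-elim)
open import Data.Nat using (ℕ; zero; suc; _+_; _*_; _^_; _≤_; _<_; _∸_; _≤?_; s≤s; z≤n)
open import Data.Nat.Coprimality using (Coprime; coprime-Bézout; coprime-divisor)
import Data.Nat.Coprimality as Coprimality
open import Data.Nat.Divisibility using (_∣_; _∣?_; divides; ∣-trans; ∣1⇒≡1; ∣m+n∣m⇒∣n; m∣m*n)
open import Data.Nat.GCD using (module Bézout)
open import Data.Nat.Properties
open import Data.Nat.Tactic.RingSolver using (solve-∀)
open import Data.Product using (_×_; ∃-syntax; _,_)
open import Data.Sum using (_⊎_; inj₁; inj₂)
open import Function.Bundles using (_⇔_; mk⇔)
open import Function.Properties.Equivalence using () renaming (trans to ⇔-trans)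
open import Level using (0ℓ)
open import Relation.Nullary using (¬_; yes; no)
open import Relation.Nullary.Decidable using (map′; _×-dec_)
open import Relation.Unary using (Pred; Decidable)
open import Relation.Binary.PropositionalEquality

module _ (P : Pred ℕ 0ℓ) (P? : Decidable P) where

  private
    search : ∀ b → (∃[ a ] (P a × (∀ {k} → P k → a ≤ k))) ⊎ (∀ {k} → k < b → ¬ P k)
    search zero = inj₂ λ ()
    search (suc b) with search b | P? b
    ... | inj₁ least | _      = inj₁ least
    ... | inj₂ none  | yes pb = inj₁ (b , pb , λ pk → ≮⇒≥ λ k<b → none k<b pk)
    ... | inj₂ none  | no ¬pb = inj₂ λ k<1+b → case-below (m<1+n⇒m<n∨m≡n k<1+b)
      where
      case-below : ∀ {k} → k < b ⊎ k ≡ b → ¬ P k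
      case-below (inj₁ k<b)  = none k<b
      case-below (inj₂ refl) = ¬pb

  least-witness : ∀ {b} → P b → ∃[ a ] (P a × (∀ {k} → P k → a ≤ k))
  least-witness {b} pb with search (suc b)
  ... | inj₁ least = least
  ... | inj₂ none  = ⊥-elim (none ≤-refl pb)

coprime-* : ∀ {p a b} → Coprime p a → Coprime p b → Coprime p (a * b)
coprime-* {b = b} ca cb (i∣p , i∣ab) =
  cb (i∣p , coprime-divisor {o = b} (λ (j∣i , j∣a) → ca (∣-trans j∣i i∣p , j∣a)) i∣ab)

coprime-^ : ∀ {p r} m → Coprime p r → Coprime p (r ^ m)
coprime-^ zero    _   (_ , i∣1) = ∣1⇒≡1 i∣1
coprime-^ (suc m) cpr = coprime-* cpr (coprime-^ m cpr)

coprime⇒inverse : ∀ {p R} → 1 < R → Coprime p R → ∃[ x ] ∃[ y ] (x * p ≡ 1 + y * R)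
coprime⇒inverse {p} {suc (suc R₀)} (s≤s (s≤s z≤n)) cop with coprime-Bézout cop
... | Bézout.+- x y eq = x , y , sym eq
... | Bézout.-+ x zero eq = ⊥-elim (1+n≢0 eq)
-- Multiplying 1 + x * p ≡ y * R by R − 1 turns (R − 1) * x into an inverse of p modulo R.
... | Bézout.-+ x (suc y₀) eq = x * suc R₀ , y₀ + R₀ * suc y₀ , +-cancelˡ-≡ (suc R₀) _ _ (begin
  suc R₀ + x * suc R₀ * p                        ≡⟨ expand-left R₀ x p ⟩
  suc R₀ * (1 + x * p)                           ≡⟨ cong (suc R₀ *_) eq ⟩
  suc R₀ * (suc y₀ * suc (suc R₀))               ≡⟨ expand-right R₀ y₀ ⟩
  suc R₀ + (1 + (y₀ + R₀ * suc y₀) * suc (suc R₀)) ∎)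
  where
  open ≡-Reasoning
  expand-left : ∀ R₀ x p → suc R₀ + x * suc R₀ * p ≡ suc R₀ * (1 + x * p)
  expand-left = solve-∀
  expand-right : ∀ R₀ y₀ → suc R₀ * (suc y₀ * suc (suc R₀))
                         ≡ suc R₀ + (1 + (y₀ + R₀ * suc y₀) * suc (suc R₀))
  expand-right = solve-∀

InAP : ℕ → ℕ → ℕ → Set
InAP a d x = ∃[ j ] (x ≡ a + d * j)

inAP? : ∀ a d → Decidable (InAP a d)
inAP? a d x = map′ from to (a ≤? x ×-dec d ∣? (x ∸ a))
  where
  from : a ≤ x × d ∣ x ∸ a → InAP a d x
  from (a≤x , divides j eq) = j , trans (sym (m+[n∸m]≡n a≤x)) (cong (a +_) (trans eq (*-comm j d)))
  to : InAP a d x → a ≤ x × d ∣ x ∸ a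
  to (j , refl) = m≤m+n a (d * j) , divides j (trans (m+n∸m≡n a (d * j)) (*-comm d j))

inAP-+* : ∀ {a d x} → InAP a d x → ∀ i → InAP a d (x + d * i)
inAP-+* {a} {d} (j , refl) i = j + i , (begin
  a + d * j + d * i   ≡⟨ +-assoc a (d * j) (d * i) ⟩
  a + (d * j + d * i) ≡⟨ cong (a +_) (*-distribˡ-+ d j i) ⟨
  a + d * (j + i)     ∎)
  where open ≡-Reasoning

inAP-+⇒∣ : ∀ {a d x e} → InAP a d x → InAP a d (x + e) → d ∣ e
inAP-+⇒∣ {a} {d} {e = e} (i , refl) (j , eq) = ∣m+n∣m⇒∣n (subst (d ∣_) dj≡di+e (m∣m*n j)) (m∣m*n i)
  where
  dj≡di+e : d * j ≡ d * i + e
  dj≡di+e = +-cancelˡ-≡ a _ _ (trans (sym eq) (+-assoc a (d * i) e))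

sample-shift : ∀ p c R k j → (k + R * j) * p + c ≡ (k * p + c) + R * (j * p)
sample-shift = solve-∀

sample-+ : ∀ p c a d → (a + d) * p + c ≡ (a * p + c) + p * d
sample-+ = solve-∀

module _ (p c n R : ℕ) where

  inAP⇒sampled-inAP : ∀ {a k} → InAP n R (a * p + c) → InAP a R k → InAP n R (k * p + c)
  inAP⇒sampled-inAP {a} sa (j , refl) =
    subst (InAP n R) (sym (sample-shift p c R a j)) (inAP-+* {n} {R} sa (j * p))

  sampled-inAP⇒inAP : ∀ {a k} → Coprime R p → InAP n R (a * p + c) → InAP n R (k * p + c) →
                      a ≤ k → InAP a R k
  sampled-inAP⇒inAP {a} cop sa sk a≤k with m≤n⇒∃[o]m+o≡n a≤k
  ... | d , refl
    with coprime-divisor cop (inAP-+⇒∣ {n} {R} sa (subst (InAP n R) (sample-+ p c a d) sk))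
  ...   | divides t refl = t , cong (a +_) (*-comm t R)

sampled-inAP-exists : ∀ {p R} n c → 1 < R → Coprime p R → ∃[ k ] InAP n R (k * p + c)
sampled-inAP-exists {p} {suc R′} n c 1<R cop with coprime⇒inverse 1<R cop
... | x , y , xp≡1+yR = x * t , c + y * t , (begin
  x * t * p + c             ≡⟨ reassociate x t p c ⟩
  t * (x * p) + c           ≡⟨ cong (λ u → t * u + c) xp≡1+yR ⟩
  t * (1 + y * suc R′) + c  ≡⟨ collect n R′ c y ⟩
  n + suc R′ * (c + y * t)  ∎)
  where
  open ≡-Reasoning
  -- t ≥ n and t + c ≡ n modulo R, while x * t * p ≡ t modulo R.
  t : ℕ
  t = n + R′ * c
  reassociate : ∀ x t p c → x * t * p + c ≡ t * (x * p) + c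
  reassociate = solve-∀
  collect : ∀ n R′ c y → (n + R′ * c) * (1 + y * suc R′) + c
                       ≡ n + suc R′ * (c + y * (n + R′ * c))
  collect = solve-∀

sampled-inAP⇔inAP : ∀ {p R} n c → 1 < R → Coprime p R →
                    ∃[ a ] (∀ k → InAP n R (k * p + c) ⇔ InAP a R k)
sampled-inAP⇔inAP {p} {R} n c 1<R cop with sampled-inAP-exists n c 1<R cop
... | k₀ , sk₀
  with least-witness (λ k → InAP n R (k * p + c)) (λ k → inAP? n R (k * p + c)) {k₀} sk₀
...   | a , sa , least = a , λ k → mk⇔
  (λ sk → sampled-inAP⇒inAP p c n R (Coprimality.sym cop) sa sk (least sk))
  (inAP⇒sampled-inAP p c n R sa)

lemma8 : {A : Set} (r : ℕ) → 2 ≤ r → (q : ℕ → A) →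
    ((k : ℕ) → 1 ≤ k → ∃[ m ] ∃[ n ] PositionsAP r q (q k) m n) →
    (p c : ℕ) → 1 ≤ p → 1 ≤ c → Coprime p r →
    (v : A) → ∃[ k ] ((1 ≤ k) × (q k ≡ v)) →
    (m n : ℕ) → PositionsAP r q v m n →
    ∃[ a ] ((k : ℕ) → ((q (k * p + c) ≡ v) ⇔ (∃[ j ] (k ≡ a + r ^ m * j))))
lemma8 r 2≤r q _ p c _ 1≤c p⊥r v _ m n (1≤m , _ , _ , positions)
  with sampled-inAP⇔inAP n c (^-monoʳ-< r 2≤r {0} {m} 1≤m) (coprime-^ m p⊥r)
... | a , sampling = a , λ k →
  ⇔-trans (positions (k * p + c) (≤-trans 1≤c (m≤n+m c (k * p)))) (sampling k)
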